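{- For every positive integer $n$, $$\operatorname{lcm}_{k\in\{1,\dots,n\}}\left(\binom{n}{k}\cdot k\right)=\operatorname{lcm}(1,2,\dots,n).$$ -}

module Defs where

open import Data.Nat using (ℕ; suc; _*_)
open import Data.Nat.LCM using (lcm)
open import Data.Nat.Combinatorics using (_C_)
open import Data.List using (List; foldr; map; upTo)

lcmList : List ℕ → ℕ
lcmList = foldr lcm 1

oneTo : ℕ → List ℕ
oneTo n = map suc (upTo n)

lcmOver1To : ℕ → (ℕ → ℕ) → ℕ
lcmOver1To n f = lcmList (map f (oneTo n))

-- For a ≥ 1 put  leibniz a b = (a + b) C a · a.  Its reciprocals form Leibniz's
-- harmonic triangle: the absorption identity for binomial coefficients gives
--     1 / leibniz a b  =  1 / leibniz (a + 1) b  +  1 / leibniz a (b + 1),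
-- i.e.  x·y + x·z = y·z  for x, y, z the three entries.  Whenever positive
-- x, y, z satisfy this relation, any common multiple of two of them is a
-- multiple of the third (x from y and z, z from x and y).
--
-- The column b = 0 is  leibniz a 0 = a  and the row a + b = n consists of the
-- numbers (n C a) · a.  Spreading divisibility through the triangle therefore
-- shows: a common multiple of 1, …, n is a multiple of every entry with
-- a + b ≤ n (induction on b), in particular of the whole row n; and a common
-- multiple of row n is a multiple of every entry above it (induction on the
-- distance to the row), in particular of 1, …, n.  The two lcm's divide each
-- other and are hence equal.
module Submission where

open import Defs
open import Data.Nat using (ℕ; zero; suc; _+_; _*_; _∸_; _≤_; _<_; z≤n; s≤s; NonZero; >-nonZero)
open import Data.Nat.Properties
open import Data.Nat.Combinatorics using (_C_; nCk+nC[k+1]≡[n+1]C[k+1]; nCk≡nC[n∸k]; nCn≡1; nC1≡n; k>n⇒nCk≡0)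
open import Data.Nat.Divisibility using (_∣_; ∣-refl; ∣-trans; ∣-antisym; 1∣_; *-pres-∣; ∣m∣n⇒∣m+n; ∣m+n∣m⇒∣n; *-cancelʳ-∣)
open import Data.Nat.LCM using (m∣lcm[m,n]; n∣lcm[m,n]; lcm-least)
open import Data.Nat.Solver using (module +-*-Solver)
open import Data.List using ([]; _∷_; map)
open import Data.List.Membership.Propositional using (_∈_)
open import Data.List.Membership.Propositional.Properties using (∈-map⁺; ∈-map⁻; ∈-upTo⁺; ∈-upTo⁻)
open import Data.List.Relation.Unary.Any using (here; there)
open import Data.Product using (_,_)
open import Relation.Binary.PropositionalEquality using (_≡_; refl; sym; trans; cong; cong₂; subst; module ≡-Reasoning)
open import Algebra.Properties.CommutativeSemigroup *-commutativeSemigroup using (x∙yz≈y∙xz)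

open +-*-Solver using (solve; _:+_; _:*_; _:=_; con)
open ≡-Reasoning

∣-lcmList : ∀ {x xs} → x ∈ xs → x ∣ lcmList xs
∣-lcmList {x} {y ∷ ys} (here refl) = m∣lcm[m,n] x (lcmList ys)
∣-lcmList {x} {y ∷ ys} (there x∈ys) = ∣-trans (∣-lcmList x∈ys) (n∣lcm[m,n] y (lcmList ys))

lcmList-least : ∀ {M} xs → (∀ {x} → x ∈ xs → x ∣ M) → lcmList xs ∣ M
lcmList-least []       _   = 1∣ _
lcmList-least (y ∷ ys) all = lcm-least (all (here refl)) (lcmList-least ys (λ p → all (there p)))

∣-lcmOver1To : ∀ {n} (f : ℕ → ℕ) k → 1 ≤ k → k ≤ n → f k ∣ lcmOver1To n f
∣-lcmOver1To f (suc j) _ j<n = ∣-lcmList (∈-map⁺ f (∈-map⁺ suc (∈-upTo⁺ j<n)))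

lcmOver1To-least : ∀ {n M} (f : ℕ → ℕ) → (∀ k → 1 ≤ k → k ≤ n → f k ∣ M) → lcmOver1To n f ∣ M
lcmOver1To-least {n} {M} f all = lcmList-least _ divides
  where
  divides : ∀ {x} → x ∈ map f (oneTo n) → x ∣ M
  divides x∈ with ∈-map⁻ f x∈
  ... | _ , k∈ , refl with ∈-map⁻ suc k∈
  ... | j , j∈ , refl = all (suc j) (s≤s z≤n) (∈-upTo⁻ j∈)

-- Divisibility across a harmonic relation  1/x = 1/y + 1/z,  i.e.  x·y + x·z = y·z.
-- The product  x·y·z  serves as a pivot: multiplying M by the product of any two
-- of x, y, z gives a multiple of it as soon as the third one divides M.
module Harmonic {x y z : ℕ} (relation : x * y + x * z ≡ y * z) {M : ℕ} where

  scaled : M * (x * y) + M * (x * z) ≡ M * (y * z)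
  scaled = trans (sym (*-distribˡ-+ M (x * y) (x * z))) (cong (M *_) relation)

  pivot-z : z * (x * y) ≡ x * (y * z)
  pivot-z = trans (*-comm z (x * y)) (*-assoc x y z)

  via-x : x ∣ M → x * (y * z) ∣ M * (y * z)
  via-x x∣M = *-pres-∣ x∣M ∣-refl

  via-y : y ∣ M → x * (y * z) ∣ M * (x * z)
  via-y y∣M = subst (_∣ M * (x * z)) (x∙yz≈y∙xz y x z) (*-pres-∣ y∣M ∣-refl)

  via-z : z ∣ M → x * (y * z) ∣ M * (x * y)
  via-z z∣M = subst (_∣ M * (x * y)) pivot-z (*-pres-∣ z∣M ∣-refl)

  sum-∣ : .{{NonZero (y * z)}} → y ∣ M → z ∣ M → x ∣ M
  sum-∣ y∣M z∣M =
    *-cancelʳ-∣ (y * z) (subst (x * (y * z) ∣_) scaled (∣m∣n⇒∣m+n (via-z z∣M) (via-y y∣M)))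

  difference-∣ : .{{NonZero (x * y)}} → x ∣ M → y ∣ M → z ∣ M
  difference-∣ x∣M y∣M = *-cancelʳ-∣ (x * y) (subst (_∣ M * (x * y)) (sym pivot-z) pivot∣M·xy)
    where
    pivot∣M·xy : x * (y * z) ∣ M * (x * y)
    pivot∣M·xy = ∣m+n∣m⇒∣n (subst (x * (y * z) ∣_) scaled′ (via-x x∣M)) (via-y y∣M)
      where
      scaled′ : M * (y * z) ≡ M * (x * z) + M * (x * y)
      scaled′ = trans (sym scaled) (+-comm (M * (x * y)) (M * (x * z)))

absorption : ∀ n k → suc k * (suc n C suc k) ≡ suc n * (n C k)
absorption n zero = trans (+-identityʳ (suc n C 1)) (trans (nC1≡n (suc n)) (sym (*-identityʳ (suc n))))
absorption zero (suc k) = trans (cong (suc (suc k) *_) (k>n⇒nCk≡0 {1} {2 + k} (s≤s (s≤s z≤n)))) (*-zeroʳ (suc (suc k)))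
absorption (suc n) (suc k) = begin
    (2 + k) * ((2 + n) C (2 + k))
  ≡⟨ cong ((2 + k) *_) (nCk+nC[k+1]≡[n+1]C[k+1] (suc n) (suc k)) ⟨
    (2 + k) * (suc n C (1 + k) + suc n C (2 + k))
  ≡⟨ solve 3 (λ k u v → (con 2 :+ k) :* (u :+ v) := u :+ ((con 1 :+ k) :* u :+ (con 2 :+ k) :* v)) refl k u v ⟩
    u + ((1 + k) * u + (2 + k) * v)
  ≡⟨ cong (u +_) (cong₂ _+_ (absorption n k) (absorption n (suc k))) ⟩
    u + ((1 + n) * (n C k) + (1 + n) * (n C suc k))
  ≡⟨ cong (u +_) (sym (*-distribˡ-+ (1 + n) (n C k) (n C suc k))) ⟩
    u + (1 + n) * (n C k + n C suc k)
  ≡⟨ cong (λ t → u + (1 + n) * t) (nCk+nC[k+1]≡[n+1]C[k+1] n k) ⟩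
    (2 + n) * u
  ∎
  where
  u v : ℕ
  u = suc n C suc k
  v = suc n C suc (suc k)

symmetry : ∀ a b → (a + b) C a ≡ (a + b) C b
symmetry a b = trans (nCk≡nC[n∸k] (m≤m+n a b)) (cong ((a + b) C_) (m+n∸m≡n a b))

co-absorption : ∀ a b → suc b * ((a + suc b) C a) ≡ suc (a + b) * ((a + b) C a)
co-absorption a b = begin
    suc b * ((a + suc b) C a)        ≡⟨ cong (suc b *_) (symmetry a (suc b)) ⟩
    suc b * ((a + suc b) C suc b)    ≡⟨ cong (λ m → suc b * (m C suc b)) (+-suc a b) ⟩
    suc b * (suc (a + b) C suc b)    ≡⟨ absorption (a + b) b ⟩
    suc (a + b) * ((a + b) C b)      ≡⟨ cong (suc (a + b) *_) (symmetry a b) ⟨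
    suc (a + b) * ((a + b) C a)      ∎

C-positive : ∀ a b → 0 < (a + b) C a
C-positive zero    b = s≤s z≤n
C-positive (suc a) b = subst (0 <_) (nCk+nC[k+1]≡[n+1]C[k+1] (a + b) a) (≤-trans (C-positive a b) (m≤m+n _ _))

-- Leibniz's harmonic triangle, through the reciprocals of its entries (a ≥ 1).
leibniz : ℕ → ℕ → ℕ
leibniz a b = ((a + b) C a) * a

leibniz-row : ∀ a b {n} → a + b ≡ n → leibniz a b ≡ (n C a) * a
leibniz-row a b eq = cong (λ m → (m C a) * a) eq

leibniz-column : ∀ a → leibniz a 0 ≡ a
leibniz-column a = trans (leibniz-row a 0 (+-identityʳ a)) (trans (cong (_* a) (nCn≡1 a)) (*-identityˡ a))

leibniz-nonZero : ∀ a b → 1 ≤ a → NonZero (leibniz a b)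
leibniz-nonZero (suc a) b _ = m*n≢0 _ (suc a) {{>-nonZero (C-positive (suc a) b)}}

leibniz-suc-left : ∀ a b → leibniz (suc a) b ≡ suc (a + b) * ((a + b) C a)
leibniz-suc-left a b = trans (*-comm ((suc a + b) C suc a) (suc a)) (absorption (a + b) a)

-- The harmonic rule  1/leibniz a b = 1/leibniz (a+1) b + 1/leibniz a (b+1),
-- cleared of denominators.
leibniz-rule : ∀ a b → leibniz a b * leibniz (suc a) b + leibniz a b * leibniz a (suc b)
                      ≡ leibniz (suc a) b * leibniz a (suc b)
leibniz-rule a b = begin
    x * leibniz (suc a) b + x * (w * a)   ≡⟨ cong (λ y → x * y + x * (w * a)) (leibniz-suc-left a b) ⟩
    x * (suc (a + b) * c) + x * (w * a)   ≡⟨ *-distribˡ-+ x (suc (a + b) * c) (w * a) ⟨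
    x * (suc (a + b) * c + w * a)         ≡⟨ cong (λ t → x * (t + w * a)) (co-absorption a b) ⟨
    x * (suc b * w + w * a)               ≡⟨ rearrange a b c w ⟩
    (suc (a + b) * c) * (w * a)           ≡⟨ cong (_* (w * a)) (leibniz-suc-left a b) ⟨
    leibniz (suc a) b * (w * a)           ∎
  where
  c w x : ℕ
  c = (a + b) C a
  w = (a + suc b) C a
  x = c * a
  rearrange : ∀ a b c w → c * a * (suc b * w + w * a) ≡ (suc (a + b) * c) * (w * a)
  rearrange = solve 4 (λ a b c w → c :* a :* ((con 1 :+ b) :* w :+ w :* a)
                                    := ((con 1 :+ (a :+ b)) :* c) :* (w :* a)) refl

range-∣⇒triangle-∣ : ∀ {n M} → (∀ k → 1 ≤ k → k ≤ n → k ∣ M) →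
                     ∀ b a → 1 ≤ a → a + b ≤ n → leibniz a b ∣ M
range-∣⇒triangle-∣ {n} {M} range∣ zero a 1≤a a≤n =
  subst (_∣ M) (sym (leibniz-column a)) (range∣ a 1≤a (subst (_≤ n) (+-identityʳ a) a≤n))
range-∣⇒triangle-∣ {n} range∣ (suc b) a 1≤a a+b<n =
  Harmonic.difference-∣ (leibniz-rule a b) {{nonZero}}
    (range-∣⇒triangle-∣ range∣ b a 1≤a (≤-trans (+-monoʳ-≤ a (n≤1+n b)) a+b<n))
    (range-∣⇒triangle-∣ range∣ b (suc a) (s≤s z≤n) (subst (_≤ n) (+-suc a b) a+b<n))
  where
  nonZero : NonZero (leibniz a b * leibniz (suc a) b)
  nonZero = m*n≢0 _ _ {{leibniz-nonZero a b 1≤a}} {{leibniz-nonZero (suc a) b (s≤s z≤n)}}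

row-∣⇒triangle-∣ : ∀ {n M} → (∀ a b → 1 ≤ a → a + b ≡ n → leibniz a b ∣ M) →
                   ∀ j a b → 1 ≤ a → a + b + j ≡ n → leibniz a b ∣ M
row-∣⇒triangle-∣ row∣ zero a b 1≤a eq = row∣ a b 1≤a (trans (sym (+-identityʳ (a + b))) eq)
row-∣⇒triangle-∣ {n} row∣ (suc j) a b 1≤a eq =
  Harmonic.sum-∣ (leibniz-rule a b) {{nonZero}}
    (row-∣⇒triangle-∣ row∣ j (suc a) b (s≤s z≤n) next-row)
    (row-∣⇒triangle-∣ row∣ j a (suc b) 1≤a (trans (cong (_+ j) (+-suc a b)) next-row))
  where
  next-row : suc (a + b + j) ≡ n
  next-row = trans (sym (+-suc (a + b) j)) eq
  nonZero : NonZero (leibniz (suc a) b * leibniz a (suc b))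
  nonZero = m*n≢0 _ _ {{leibniz-nonZero (suc a) b (s≤s z≤n)}} {{leibniz-nonZero a (suc b) 1≤a}}

-- The two lcm's are multiples of each other: the row n of the triangle is
-- {(n C k) · k}, and its column b = 0 below row n is {1, …, n}.
lemma7 : (n : ℕ) → 1 ≤ n → lcmOver1To n (λ k → (n C k) * k) ≡ lcmOver1To n (λ k → k)
lemma7 n _ = ∣-antisym
  (lcmOver1To-least {n} row λ k 1≤k k≤n →
     subst (_∣ lcmOver1To n range) (leibniz-row k (n ∸ k) (m+[n∸m]≡n k≤n))
       (range-∣⇒triangle-∣ (∣-lcmOver1To range) (n ∸ k) k 1≤k (≤-reflexive (m+[n∸m]≡n k≤n))))
  (lcmOver1To-least {n} range λ k 1≤k k≤n →
     subst (_∣ lcmOver1To n row) (leibniz-column k)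
       (row-∣⇒triangle-∣ row∣ (n ∸ k) k 0 1≤k (trans (cong (_+ (n ∸ k)) (+-identityʳ k)) (m+[n∸m]≡n k≤n))))
  where
  row range : ℕ → ℕ
  row k = (n C k) * k
  range k = k
  row∣ : ∀ a b → 1 ≤ a → a + b ≡ n → leibniz a b ∣ lcmOver1To n row
  row∣ a b 1≤a a+b≡n = subst (_∣ lcmOver1To n row) (sym (leibniz-row a b a+b≡n))
                         (∣-lcmOver1To row a 1≤a (subst (a ≤_) a+b≡n (m≤m+n a b)))
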